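{- Let $G$ be a regular finite simple graph with $n\ge1$ vertices and $m$ edges. Then \[NK(G^{ -- }) = (n-2)^{m}\left[(n+m-1)-\frac{4m}{n}\right]^{n}.\]
   Context: For a graph $H$, $NK(H)=\prod_{v\in V(H)} d_H(v)$ (Narumi-Katayama index). For $a,b\in\{+,-\}$ the transformation graph $G^{ab}$ has vertex set $V(G)\cup E(G)$ (disjoint union), with adjacency: two vertices $u,v\in V(G)$ are adjacent in $G^{ab}$ iff they are adjacent in $G$ (when $a=+$), resp. not adjacent in $G$ (when $a=-$); a vertex $u\in V(G)$ and an edge $e\in E(G)$ are adjacent in $G^{ab}$ iff $u$ is incident to $e$ (when $b=+$), resp. not incident (when $b=-$); two elements of $E(G)$ are never adjacent in $G^{ab}$. -}

module Defs where

open import Data.Bool using (Bool; true; false; not; _∧_; _∨_; if_then_else_)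
open import Data.Nat using (ℕ; zero; suc; _<ᵇ_)
open import Data.Fin using (Fin; toℕ; _≟_)
open import Data.List using (List; []; _∷_; _++_; map; filter; length; allFin; concatMap)
open import Data.Product using (_×_; _,_; Σ; ∃)
open import Data.Sum using (_⊎_; inj₁; inj₂)
open import Relation.Binary.PropositionalEquality using (_≡_)
open import Relation.Nullary using (¬_; does)
open import Data.Rational using (ℚ; 1ℚ; _*_)
open import Data.Nat.ListAction using (product)

bfilter : ∀ {A : Set} → (A → Bool) → List A → List A
bfilter p [] = []
bfilter p (x ∷ xs) = if p x then x ∷ bfilter p xs else bfilter p xs

record SimpleGraph (n : ℕ) : Set where
  field
    adj   : Fin n → Fin n → Bool
    sym   : ∀ u v → adj u v ≡ adj v u
    irrefl : ∀ v → adj v v ≡ false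
open SimpleGraph public

edges : ∀ {n} → SimpleGraph n → List (Fin n × Fin n)
edges {n} G =
  bfilter (λ p → (toℕ (Data.Product.proj₁ p) <ᵇ toℕ (Data.Product.proj₂ p)) ∧ adj G (Data.Product.proj₁ p) (Data.Product.proj₂ p))
    (concatMap (λ i → map (λ j → (i , j)) (allFin n)) (allFin n))

numEdges : ∀ {n} → SimpleGraph n → ℕ
numEdges G = length (edges G)

deg : ∀ {n} → SimpleGraph n → Fin n → ℕ
deg {n} G v = length (bfilter (adj G v) (allFin n))

Regular : ∀ {n} → SimpleGraph n → Set
Regular {n} G = ∃ λ r → ∀ v → deg G v ≡ r

data Sign : Set where
  plus minus : Sign

sgn : Sign → Bool → Bool
sgn plus  x = x
sgn minus x = not x

-- vertices of the transformation graph: V(G) ⊎ E(G)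
TVert : ℕ → Set
TVert n = Fin n ⊎ (Fin n × Fin n)

tVertices : ∀ {n} → SimpleGraph n → List (TVert n)
tVertices {n} G = map inj₁ (allFin n) ++ map inj₂ (edges G)

incident : ∀ {n} → Fin n → Fin n × Fin n → Bool
incident u (x , y) = does (u ≟ x) ∨ does (u ≟ y)

tAdj : ∀ {n} → Sign → Sign → SimpleGraph n → TVert n → TVert n → Bool
tAdj a b G (inj₁ u) (inj₁ v) = not (does (u ≟ v)) ∧ sgn a (adj G u v)
tAdj a b G (inj₁ u) (inj₂ e) = sgn b (incident u e)
tAdj a b G (inj₂ e) (inj₁ u) = sgn b (incident u e)
tAdj a b G (inj₂ e) (inj₂ f) = false

tDeg : ∀ {n} → Sign → Sign → SimpleGraph n → TVert n → ℕ
tDeg a b G x = length (bfilter (tAdj a b G x) (tVertices G))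

NKtrans : ∀ {n} → Sign → Sign → SimpleGraph n → ℕ
NKtrans a b G = product (map (tDeg a b G) (tVertices G))

_^ℚ_ : ℚ → ℕ → ℚ
q ^ℚ zero  = 1ℚ
q ^ℚ suc k = q * (q ^ℚ k)

-- In G⁻⁻ an original vertex u is adjacent to the n − 1 − d(u) vertices it
-- misses in G and to the m − d(u) edges not incident to it, while an edge is
-- adjacent to the n − 2 vertices other than its endpoints.  For an r-regular
-- graph the handshake lemma gives n r = 2m, so every vertex of G⁻⁻ has degree
-- n + m − 1 − 2r = (n + m − 1) − 4m/n, and NK(G⁻⁻) is the product of the two
-- constant degrees raised to the multiplicities n and m.
module Submission where

module Sums where

  open import Defs using (bfilter)
  open import Data.Bool using (Bool; true; false; not; if_then_else_)
  open import Data.Nat using (ℕ; suc; _+_; _*_)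
  open import Data.Nat.Properties
    using (+-assoc; +-identityʳ; *-identityʳ; +-commutativeSemigroup)
  open import Algebra.Properties.CommutativeSemigroup +-commutativeSemigroup
    using (interchange)
  open import Data.Fin using (Fin; _≟_)
  open import Data.List using (List; []; _∷_; _++_; map; length; allFin; concatMap)
  open import Data.List.Properties using (map-tabulate; length-tabulate)
  open import Data.List.Relation.Unary.All using (All; []; _∷_)
  open import Function using (id)
  open import Data.Empty using (⊥-elim)
  open import Relation.Nullary using (does; yes; no)
  open import Relation.Binary.PropositionalEquality

  private variable
    A B : Set
    n : ℕ

  ⟦_⟧ : Bool → ℕ
  ⟦ b ⟧ = if b then 1 else 0

  ∑ : List A → (A → ℕ) → ℕ
  ∑ []       f = 0
  ∑ (x ∷ xs) f = f x + ∑ xs f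

  syntax ∑ xs (λ x → e) = ∑[ x ∈ xs ] e

  length-bfilter : (p : A → Bool) (xs : List A) →
                   length (bfilter p xs) ≡ ∑[ x ∈ xs ] ⟦ p x ⟧
  length-bfilter p []       = refl
  length-bfilter p (x ∷ xs) with p x
  ... | true  = cong suc (length-bfilter p xs)
  ... | false = length-bfilter p xs

  ∑-++ : (xs ys : List A) (f : A → ℕ) → ∑ (xs ++ ys) f ≡ ∑ xs f + ∑ ys f
  ∑-++ []       ys f = refl
  ∑-++ (x ∷ xs) ys f = trans (cong (f x +_) (∑-++ xs ys f)) (sym (+-assoc (f x) _ _))

  ∑-map : (g : A → B) (xs : List A) (f : B → ℕ) →
          ∑ (map g xs) f ≡ ∑[ x ∈ xs ] f (g x)
  ∑-map g []       f = refl
  ∑-map g (x ∷ xs) f = cong (f (g x) +_) (∑-map g xs f)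

  ∑-cong : {f g : A → ℕ} (xs : List A) → (∀ x → f x ≡ g x) → ∑ xs f ≡ ∑ xs g
  ∑-cong []       f≗g = refl
  ∑-cong (x ∷ xs) f≗g = cong₂ _+_ (f≗g x) (∑-cong xs f≗g)

  ∑-cong-All : {f g : A → ℕ} {xs : List A} → All (λ x → f x ≡ g x) xs → ∑ xs f ≡ ∑ xs g
  ∑-cong-All []           = refl
  ∑-cong-All (fx≡gx ∷ eqs) = cong₂ _+_ fx≡gx (∑-cong-All eqs)

  ∑-distrib-+ : (xs : List A) (f g : A → ℕ) →
                ∑[ x ∈ xs ] (f x + g x) ≡ ∑ xs f + ∑ xs g
  ∑-distrib-+ []       f g = refl
  ∑-distrib-+ (x ∷ xs) f g =
    trans (cong (f x + g x +_) (∑-distrib-+ xs f g)) (interchange (f x) (g x) _ _)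

  ∑-zero : (xs : List A) → ∑[ x ∈ xs ] 0 ≡ 0
  ∑-zero []       = refl
  ∑-zero (x ∷ xs) = ∑-zero xs

  ∑-const : (xs : List A) (c : ℕ) → ∑[ x ∈ xs ] c ≡ length xs * c
  ∑-const []       c = refl
  ∑-const (x ∷ xs) c = cong (c +_) (∑-const xs c)

  ∑-comm : (xs : List A) (ys : List B) (f : A → B → ℕ) →
           ∑[ x ∈ xs ] ∑[ y ∈ ys ] f x y ≡ ∑[ y ∈ ys ] ∑[ x ∈ xs ] f x y
  ∑-comm []       ys f = sym (∑-zero ys)
  ∑-comm (x ∷ xs) ys f =
    trans (cong (∑ ys (f x) +_) (∑-comm xs ys f))
          (sym (∑-distrib-+ ys (f x) (λ y → ∑[ x′ ∈ xs ] f x′ y)))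

  ∑-concatMap : (g : A → List B) (xs : List A) (f : B → ℕ) →
                ∑ (concatMap g xs) f ≡ ∑[ x ∈ xs ] ∑ (g x) f
  ∑-concatMap g []       f = refl
  ∑-concatMap g (x ∷ xs) f =
    trans (∑-++ (g x) (concatMap g xs) f) (cong (∑ (g x) f +_) (∑-concatMap g xs f))

  ∑-bfilter : (p : A → Bool) (xs : List A) (f : A → ℕ) →
              ∑ (bfilter p xs) f ≡ ∑[ x ∈ xs ] (if p x then f x else 0)
  ∑-bfilter p []       f = refl
  ∑-bfilter p (x ∷ xs) f with p x
  ... | true  = cong (f x +_) (∑-bfilter p xs f)
  ... | false = ∑-bfilter p xs f

  ∑-if : (b : Bool) (xs : List A) (f : A → ℕ) →
         ∑[ x ∈ xs ] (if b then f x else 0) ≡ (if b then ∑ xs f else 0)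
  ∑-if true  xs f = refl
  ∑-if false xs f = ∑-zero xs

  ∑-not+∑ : (p : A → Bool) (xs : List A) →
            ∑[ x ∈ xs ] ⟦ not (p x) ⟧ + ∑[ x ∈ xs ] ⟦ p x ⟧ ≡ length xs
  ∑-not+∑ p xs = begin
    ∑[ x ∈ xs ] ⟦ not (p x) ⟧ + ∑[ x ∈ xs ] ⟦ p x ⟧  ≡⟨ ∑-distrib-+ xs _ _ ⟨
    ∑[ x ∈ xs ] (⟦ not (p x) ⟧ + ⟦ p x ⟧)            ≡⟨ ∑-cong xs (λ x → ⟦not⟧+⟦⟧ (p x)) ⟩
    ∑[ x ∈ xs ] 1                                    ≡⟨ ∑-const xs 1 ⟩
    length xs * 1                                    ≡⟨ *-identityʳ _ ⟩
    length xs                                        ∎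
    where
    open ≡-Reasoning
    ⟦not⟧+⟦⟧ : ∀ b → ⟦ not b ⟧ + ⟦ b ⟧ ≡ 1
    ⟦not⟧+⟦⟧ true  = refl
    ⟦not⟧+⟦⟧ false = refl

  All-bfilter : (p : A → Bool) (xs : List A) → All (λ x → p x ≡ true) (bfilter p xs)
  All-bfilter p []       = []
  All-bfilter p (x ∷ xs) with p x in px
  ... | true  = px ∷ All-bfilter p xs
  ... | false = All-bfilter p xs

  length-allFin : ∀ n → length (allFin n) ≡ n
  length-allFin n = length-tabulate {n = n} id

  ∑-allFin-suc : (f : Fin (suc n) → ℕ) →
                 ∑[ v ∈ allFin (suc n) ] f v ≡ f Fin.zero + ∑[ v ∈ allFin n ] f (Fin.suc v)
  ∑-allFin-suc {n} f =
    cong (f Fin.zero +_) (trans (cong (λ vs → ∑ vs f) (sym (map-tabulate id Fin.suc)))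
                                (∑-map Fin.suc (allFin n) f))

  ∑-allFin-δ : (u : Fin n) (h : Fin n → ℕ) →
               ∑[ v ∈ allFin n ] (if does (u ≟ v) then h v else 0) ≡ h u
  ∑-allFin-δ {suc n} Fin.zero h =
    trans (∑-allFin-suc (λ v → if does (Fin.zero ≟ v) then h v else 0))
          (trans (cong (h Fin.zero +_) (∑-zero (allFin n))) (+-identityʳ _))
  -- `does (suc u ≟ suc v)` reduces to `does (u ≟ v)`.
  ∑-allFin-δ {suc n} (Fin.suc u) h =
    trans (∑-allFin-suc (λ v → if does (Fin.suc u ≟ v) then h v else 0))
          (∑-allFin-δ u (λ v → h (Fin.suc v)))

  does-≟-sym : (u v : Fin n) → does (u ≟ v) ≡ does (v ≟ u)
  does-≟-sym u v with u ≟ v | v ≟ u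
  ... | yes _    | yes _    = refl
  ... | no _     | no _     = refl
  ... | yes u≡v  | no v≢u   = ⊥-elim (v≢u (sym u≡v))
  ... | no u≢v   | yes v≡u  = ⊥-elim (u≢v (sym v≡u))

module TransformationDegrees where

  open import Defs hiding (sym)
  open Sums
  open import Data.Bool using (Bool; true; false; not; _∧_; _∨_; if_then_else_)
  open import Data.Bool.Properties using (∧-zeroʳ; ∧-identityʳ)
  open import Data.Nat using (ℕ; zero; suc; _+_; _*_; _<ᵇ_)
  open import Data.Nat.Properties using (+-identityʳ; *-identityʳ; *-comm)
  open import Data.Nat.ListAction using (product)
  open import Data.Nat.ListAction.Properties using (product-++)
  open import Data.Nat.Tactic.RingSolver using (solve-∀)
  open import Data.Fin using (Fin; toℕ; _≟_)
  open import Data.Fin.Properties using (toℕ-injective)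
  open import Data.List using (List; _++_; map; length; allFin; concatMap)
  open import Data.List.Properties using (map-++; map-∘)
  open import Data.List.Relation.Unary.All as All using (All)
  open import Data.Product using (_×_; _,_; proj₁; proj₂)
  open import Data.Sum using (inj₁; inj₂)
  open import Data.Empty using (⊥-elim)
  open import Function using (_∘_; case_of_)
  open import Relation.Nullary using (does; yes; no)
  open import Relation.Binary.PropositionalEquality

  <ᵇ-irrefl : ∀ a → (a <ᵇ a) ≡ false
  <ᵇ-irrefl zero    = refl
  <ᵇ-irrefl (suc a) = <ᵇ-irrefl a

  ⟦<ᵇ⟧+⟦>ᵇ⟧ : ∀ a b → a ≢ b → ⟦ a <ᵇ b ⟧ + ⟦ b <ᵇ a ⟧ ≡ 1
  ⟦<ᵇ⟧+⟦>ᵇ⟧ zero    zero    a≢b = ⊥-elim (a≢b refl)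
  ⟦<ᵇ⟧+⟦>ᵇ⟧ zero    (suc b) a≢b = refl
  ⟦<ᵇ⟧+⟦>ᵇ⟧ (suc a) zero    a≢b = refl
  ⟦<ᵇ⟧+⟦>ᵇ⟧ (suc a) (suc b) a≢b = ⟦<ᵇ⟧+⟦>ᵇ⟧ a b (a≢b ∘ cong suc)

  if-∨ : ∀ q a b → a ∧ b ∧ q ≡ false →
         (if q then ⟦ a ∨ b ⟧ else 0) ≡ (if a then ⟦ q ⟧ else 0) + (if b then ⟦ q ⟧ else 0)
  if-∨ false false false _ = refl
  if-∨ false false true  _ = refl
  if-∨ false true  false _ = refl
  if-∨ false true  true  _ = refl
  if-∨ true  false false _ = refl
  if-∨ true  false true  _ = refl
  if-∨ true  true  false _ = refl
  if-∨ true  true  true  ()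

  ∑-incident : ∀ {n} {i j : Fin n} → i ≢ j → ∑[ u ∈ allFin n ] ⟦ incident u (i , j) ⟧ ≡ 2
  ∑-incident {n} {i} {j} i≢j = begin
    ∑[ u ∈ allFin n ] ⟦ incident u (i , j) ⟧
      ≡⟨ ∑-cong (allFin n) split ⟩
    ∑[ u ∈ allFin n ] (⟦ does (i ≟ u) ⟧ + ⟦ does (j ≟ u) ⟧)
      ≡⟨ ∑-distrib-+ (allFin n) _ _ ⟩
    ∑[ u ∈ allFin n ] ⟦ does (i ≟ u) ⟧ + ∑[ u ∈ allFin n ] ⟦ does (j ≟ u) ⟧
      ≡⟨ cong₂ _+_ (∑-allFin-δ i (λ _ → 1)) (∑-allFin-δ j (λ _ → 1)) ⟩
    2 ∎
    where
    open ≡-Reasoning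
    split : ∀ u → ⟦ incident u (i , j) ⟧ ≡ ⟦ does (i ≟ u) ⟧ + ⟦ does (j ≟ u) ⟧
    split u rewrite does-≟-sym u i | does-≟-sym u j with i ≟ u | j ≟ u
    ... | yes refl | yes refl = ⊥-elim (i≢j refl)
    ... | yes _    | no _     = refl
    ... | no _     | yes _    = refl
    ... | no _     | no _     = refl

  module _ {n : ℕ} (G : SimpleGraph n) where

    -- `edges G` unfolds to `bfilter isEdge orderedPairs`.
    isEdge : Fin n × Fin n → Bool
    isEdge p = (toℕ (proj₁ p) <ᵇ toℕ (proj₂ p)) ∧ adj G (proj₁ p) (proj₂ p)

    orderedPairs : List (Fin n × Fin n)
    orderedPairs = concatMap (λ i → map (i ,_) (allFin n)) (allFin n)

    ∑-edges : (f : Fin n × Fin n → ℕ) →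
              ∑ (edges G) f
                ≡ ∑[ i ∈ allFin n ] ∑[ j ∈ allFin n ] (if isEdge (i , j) then f (i , j) else 0)
    ∑-edges f = begin
      ∑ (bfilter isEdge orderedPairs) f
        ≡⟨ ∑-bfilter isEdge orderedPairs f ⟩
      ∑[ p ∈ orderedPairs ] (if isEdge p then f p else 0)
        ≡⟨ ∑-concatMap (λ i → map (i ,_) (allFin n)) (allFin n) _ ⟩
      ∑[ i ∈ allFin n ] ∑[ p ∈ map (i ,_) (allFin n) ] (if isEdge p then f p else 0)
        ≡⟨ ∑-cong (allFin n) (λ i → ∑-map (i ,_) (allFin n) _) ⟩
      ∑[ i ∈ allFin n ] ∑[ j ∈ allFin n ] (if isEdge (i , j) then f (i , j) else 0) ∎
      where open ≡-Reasoning

    isEdge-diagonal : ∀ u → isEdge (u , u) ≡ false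
    isEdge-diagonal u rewrite <ᵇ-irrefl (toℕ u) = refl

    isEdge⇒≢ : ∀ {i j} → isEdge (i , j) ≡ true → i ≢ j
    isEdge⇒≢ {i} isEdge-ii refl = case trans (sym (isEdge-diagonal i)) isEdge-ii of λ ()

    edges-distinct : All (λ e → proj₁ e ≢ proj₂ e) (edges G)
    edges-distinct = All.map isEdge⇒≢ (All-bfilter isEdge orderedPairs)

    ⟦isEdge⟧-orientations : ∀ u v → ⟦ isEdge (u , v) ⟧ + ⟦ isEdge (v , u) ⟧ ≡ ⟦ adj G u v ⟧
    ⟦isEdge⟧-orientations u v rewrite SimpleGraph.sym G v u with u ≟ v
    ... | yes refl rewrite <ᵇ-irrefl (toℕ u) | irrefl G u = refl
    ... | no u≢v with adj G u v
    ...   | false rewrite ∧-zeroʳ (toℕ u <ᵇ toℕ v) | ∧-zeroʳ (toℕ v <ᵇ toℕ u) = refl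
    ...   | true  rewrite ∧-identityʳ (toℕ u <ᵇ toℕ v) | ∧-identityʳ (toℕ v <ᵇ toℕ u) =
                    ⟦<ᵇ⟧+⟦>ᵇ⟧ (toℕ u) (toℕ v) (u≢v ∘ toℕ-injective)

    if-isEdge-incident : ∀ u i j →
      (if isEdge (i , j) then ⟦ incident u (i , j) ⟧ else 0)
        ≡ (if does (u ≟ i) then ⟦ isEdge (i , j) ⟧ else 0)
          + (if does (u ≟ j) then ⟦ isEdge (i , j) ⟧ else 0)
    if-isEdge-incident u i j = if-∨ (isEdge (i , j)) (does (u ≟ i)) (does (u ≟ j)) no-loop
      where
      no-loop : does (u ≟ i) ∧ does (u ≟ j) ∧ isEdge (i , j) ≡ false
      no-loop with u ≟ i | u ≟ j
      ... | yes refl | yes refl = isEdge-diagonal u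
      ... | yes _    | no _     = refl
      ... | no _     | _        = refl

    incidences≡deg : ∀ u → ∑[ e ∈ edges G ] ⟦ incident u e ⟧ ≡ deg G u
    incidences≡deg u = begin
      ∑[ e ∈ edges G ] ⟦ incident u e ⟧
        ≡⟨ ∑-edges (λ e → ⟦ incident u e ⟧) ⟩
      ∑[ i ∈ V ] ∑[ j ∈ V ] (if isEdge (i , j) then ⟦ incident u (i , j) ⟧ else 0)
        ≡⟨ ∑-cong V (λ i → trans (∑-cong V (if-isEdge-incident u i)) (∑-distrib-+ V _ _)) ⟩
      ∑[ i ∈ V ] (∑[ j ∈ V ] (if does (u ≟ i) then ⟦ isEdge (i , j) ⟧ else 0)
                  + ∑[ j ∈ V ] (if does (u ≟ j) then ⟦ isEdge (i , j) ⟧ else 0))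
        ≡⟨ ∑-distrib-+ V _ _ ⟩
      ∑[ i ∈ V ] ∑[ j ∈ V ] (if does (u ≟ i) then ⟦ isEdge (i , j) ⟧ else 0)
        + ∑[ i ∈ V ] ∑[ j ∈ V ] (if does (u ≟ j) then ⟦ isEdge (i , j) ⟧ else 0)
        ≡⟨ cong₂ _+_ (trans (∑-cong V (λ i → ∑-if (does (u ≟ i)) V _))
                            (∑-allFin-δ u (λ i → ∑[ j ∈ V ] ⟦ isEdge (i , j) ⟧)))
                     (∑-cong V (λ i → ∑-allFin-δ u (λ j → ⟦ isEdge (i , j) ⟧))) ⟩
      ∑[ v ∈ V ] ⟦ isEdge (u , v) ⟧ + ∑[ v ∈ V ] ⟦ isEdge (v , u) ⟧
        ≡⟨ ∑-distrib-+ V _ _ ⟨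
      ∑[ v ∈ V ] (⟦ isEdge (u , v) ⟧ + ⟦ isEdge (v , u) ⟧)
        ≡⟨ ∑-cong V (⟦isEdge⟧-orientations u) ⟩
      ∑[ v ∈ V ] ⟦ adj G u v ⟧
        ≡⟨ length-bfilter (adj G u) V ⟨
      deg G u ∎
      where
      open ≡-Reasoning
      V = allFin n

    handshake : ∑[ u ∈ allFin n ] deg G u ≡ numEdges G * 2
    handshake = begin
      ∑[ u ∈ allFin n ] deg G u
        ≡⟨ ∑-cong (allFin n) incidences≡deg ⟨
      ∑[ u ∈ allFin n ] ∑[ e ∈ edges G ] ⟦ incident u e ⟧
        ≡⟨ ∑-comm (allFin n) (edges G) (λ u e → ⟦ incident u e ⟧) ⟩
      ∑[ e ∈ edges G ] ∑[ u ∈ allFin n ] ⟦ incident u e ⟧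
        ≡⟨ ∑-cong-All (All.map ∑-incident edges-distinct) ⟩
      ∑[ e ∈ edges G ] 2
        ≡⟨ ∑-const (edges G) 2 ⟩
      numEdges G * 2 ∎
      where open ≡-Reasoning

    regular-handshake : ∀ {r} → (∀ u → deg G u ≡ r) → n * r ≡ 2 * numEdges G
    regular-handshake {r} regular = begin
      n * r                      ≡⟨ cong (_* r) (length-allFin n) ⟨
      length (allFin n) * r      ≡⟨ ∑-const (allFin n) r ⟨
      ∑[ u ∈ allFin n ] r        ≡⟨ ∑-cong (allFin n) regular ⟨
      ∑[ u ∈ allFin n ] deg G u  ≡⟨ handshake ⟩
      numEdges G * 2             ≡⟨ *-comm (numEdges G) 2 ⟩
      2 * numEdges G             ∎
      where open ≡-Reasoning

    tDeg-inj₁ : ∀ a b u →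
      tDeg a b G (inj₁ u)
        ≡ ∑[ v ∈ allFin n ] ⟦ not (does (u ≟ v)) ∧ sgn a (adj G u v) ⟧
          + ∑[ e ∈ edges G ] ⟦ sgn b (incident u e) ⟧
    tDeg-inj₁ a b u =
      trans (length-bfilter (tAdj a b G (inj₁ u)) (tVertices G))
            (trans (∑-++ (map inj₁ (allFin n)) (map inj₂ (edges G)) _)
                   (cong₂ _+_ (∑-map inj₁ (allFin n) _) (∑-map inj₂ (edges G) _)))

    tDeg-inj₂ : ∀ a b e → tDeg a b G (inj₂ e) ≡ ∑[ u ∈ allFin n ] ⟦ sgn b (incident u e) ⟧
    tDeg-inj₂ a b e =
      trans (length-bfilter (tAdj a b G (inj₂ e)) (tVertices G))
            (trans (∑-++ (map inj₁ (allFin n)) (map inj₂ (edges G)) _)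
                   (trans (cong₂ _+_ (∑-map inj₁ (allFin n) _)
                                     (trans (∑-map inj₂ (edges G) _) (∑-zero (edges G))))
                          (+-identityʳ _)))

    non-neighbours : ∀ u →
      ∑[ v ∈ allFin n ] ⟦ not (does (u ≟ v)) ∧ not (adj G u v) ⟧ + (1 + deg G u) ≡ n
    non-neighbours u = begin
      ∑ V missed + (1 + deg G u)
        ≡⟨ cong₂ (λ k d → ∑ V missed + (k + d)) (∑-allFin-δ u (λ _ → 1)) (sym (length-bfilter (adj G u) V)) ⟨
      ∑ V missed + (∑ V self + ∑ V adjacent)
        ≡⟨ trans (∑-distrib-+ V missed _) (cong (∑ V missed +_) (∑-distrib-+ V self adjacent)) ⟨
      ∑[ v ∈ V ] (missed v + (self v + adjacent v))
        ≡⟨ ∑-cong V exactly-one ⟩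
      ∑[ v ∈ V ] 1
        ≡⟨ ∑-const V 1 ⟩
      length V * 1
        ≡⟨ trans (*-identityʳ _) (length-allFin n) ⟩
      n ∎
      where
      open ≡-Reasoning
      V = allFin n
      missed self adjacent : Fin n → ℕ
      missed v   = ⟦ not (does (u ≟ v)) ∧ not (adj G u v) ⟧
      self v     = ⟦ does (u ≟ v) ⟧
      adjacent v = ⟦ adj G u v ⟧
      exactly-one : ∀ v → missed v + (self v + adjacent v) ≡ 1
      exactly-one v with u ≟ v
      ... | yes refl rewrite irrefl G u = refl
      ... | no _ with adj G u v
      ...   | true  = refl
      ...   | false = refl

    tDeg⁻⁻-inj₁ : ∀ u → tDeg minus minus G (inj₁ u) + (1 + 2 * deg G u) ≡ n + numEdges G
    tDeg⁻⁻-inj₁ u = begin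
      tDeg minus minus G (inj₁ u) + (1 + 2 * d)  ≡⟨ cong (_+ (1 + 2 * d)) (tDeg-inj₁ minus minus u) ⟩
      (a + b) + (1 + 2 * d)                      ≡⟨ regroup a b d ⟩
      (a + (1 + d)) + (b + d)                    ≡⟨ cong₂ _+_ (non-neighbours u) b+d≡m ⟩
      n + numEdges G                             ∎
      where
      open ≡-Reasoning
      d = deg G u
      a = ∑[ v ∈ allFin n ] ⟦ not (does (u ≟ v)) ∧ not (adj G u v) ⟧
      b = ∑[ e ∈ edges G ] ⟦ not (incident u e) ⟧
      b+d≡m : b + d ≡ numEdges G
      b+d≡m = trans (cong (b +_) (sym (incidences≡deg u))) (∑-not+∑ (incident u) (edges G))
      regroup : ∀ a b d → (a + b) + (1 + 2 * d) ≡ (a + (1 + d)) + (b + d)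
      regroup = solve-∀

    tDeg⁻⁻-inj₂ : All (λ e → tDeg minus minus G (inj₂ e) + 2 ≡ n) (edges G)
    tDeg⁻⁻-inj₂ = All.map non-endpoints edges-distinct
      where
      non-endpoints : ∀ {e} → proj₁ e ≢ proj₂ e → tDeg minus minus G (inj₂ e) + 2 ≡ n
      non-endpoints {e} i≢j =
        trans (cong₂ _+_ (tDeg-inj₂ minus minus e) (sym (∑-incident i≢j)))
              (trans (∑-not+∑ (λ u → incident u e) (allFin n)) (length-allFin n))

    NKtrans-split : ∀ a b →
      NKtrans a b G ≡ product (map (tDeg a b G ∘ inj₁) (allFin n))
                      * product (map (tDeg a b G ∘ inj₂) (edges G))
    NKtrans-split a b = begin
      product (map tD (map inj₁ (allFin n) ++ map inj₂ (edges G)))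
        ≡⟨ cong product (map-++ tD (map inj₁ (allFin n)) (map inj₂ (edges G))) ⟩
      product (map tD (map inj₁ (allFin n)) ++ map tD (map inj₂ (edges G)))
        ≡⟨ product-++ (map tD (map inj₁ (allFin n))) _ ⟩
      product (map tD (map inj₁ (allFin n))) * product (map tD (map inj₂ (edges G)))
        ≡⟨ cong₂ (λ xs ys → product xs * product ys) (map-∘ (allFin n)) (map-∘ (edges G)) ⟨
      product (map (tD ∘ inj₁) (allFin n)) * product (map (tD ∘ inj₂) (edges G)) ∎
      where
      open ≡-Reasoning
      tD = tDeg a b G

module NatEmbedding where

  open import Defs using (_^ℚ_)
  open import Data.Nat as ℕ using (ℕ; suc; NonZero)
  import Data.Nat.Properties as ℕₚ
  open import Algebra.Properties.CommutativeSemigroup ℕₚ.*-commutativeSemigroup using (x∙yz≈y∙xz)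
  open import Data.Nat.ListAction using (product)
  open import Data.Integer as ℤ using (+_)
  import Data.Integer.Properties as ℤₚ
  open import Data.Rational using (ℚ; mkℚ; _+_; _*_; _-_; _/_; -_)
  open import Data.Rational.Properties
  import Data.Rational.Unnormalised as ℚᵘ
  open import Data.Nat.Coprimality as Coprime using (1-coprimeTo)
  open import Data.List using (List; []; _∷_; map; length)
  open import Data.List.Relation.Unary.All using (All; []; _∷_)
  open import Relation.Binary.PropositionalEquality

  fromℕ : ℕ → ℚ
  fromℕ k = + k / 1

  fromℕ≡mkℚ : ∀ k → fromℕ k ≡ mkℚ (+ k) 0 (Coprime.sym (1-coprimeTo k))
  fromℕ≡mkℚ k = normalize-coprime (Coprime.sym (1-coprimeTo k))

  fromℕ-+ : ∀ a b → fromℕ (a ℕ.+ b) ≡ fromℕ a + fromℕ b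
  fromℕ-+ a b rewrite fromℕ≡mkℚ a | fromℕ≡mkℚ b =
    trans (fromℕ≡mkℚ (a ℕ.+ b)) (sym (trans (/-cong numerator refl) (fromℕ≡mkℚ (a ℕ.+ b))))
    where
    numerator : + a ℤ.* + 1 ℤ.+ + b ℤ.* + 1 ≡ + (a ℕ.+ b)
    numerator rewrite ℤₚ.*-identityʳ (+ a) | ℤₚ.*-identityʳ (+ b) = refl

  fromℕ-* : ∀ a b → fromℕ (a ℕ.* b) ≡ fromℕ a * fromℕ b
  fromℕ-* a b rewrite fromℕ≡mkℚ a | fromℕ≡mkℚ b =
    trans (fromℕ≡mkℚ (a ℕ.* b)) (sym (trans (/-cong (sym (ℤₚ.pos-* a b)) refl) (fromℕ≡mkℚ (a ℕ.* b))))

  fromℕ-cancelʳ : ∀ a b {c} → a ℕ.+ b ≡ c → fromℕ a ≡ fromℕ c - fromℕ b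
  fromℕ-cancelʳ a b refl = sym (begin
    fromℕ (a ℕ.+ b) - fromℕ b        ≡⟨ cong (_- fromℕ b) (fromℕ-+ a b) ⟩
    fromℕ a + fromℕ b - fromℕ b      ≡⟨ +-assoc (fromℕ a) (fromℕ b) (- fromℕ b) ⟩
    fromℕ a + (fromℕ b - fromℕ b)    ≡⟨ cong (λ x → fromℕ a + x) (+-inverseʳ (fromℕ b)) ⟩
    fromℕ a + 0ℚ                     ≡⟨ +-identityʳ (fromℕ a) ⟩
    fromℕ a                          ∎)
    where
    open ≡-Reasoning
    open Data.Rational using (0ℚ)

  *-/-cancelˡ : ∀ n k .{{_ : NonZero n}} → + (n ℕ.* k) / n ≡ fromℕ k
  *-/-cancelˡ n@(suc n-1) k =
    fromℚᵘ-cong {ℚᵘ.mkℚᵘ (+ (n ℕ.* k)) n-1} {ℚᵘ.mkℚᵘ (+ k) 0} (ℚᵘ.*≡* cross)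
    where
    cross : + (n ℕ.* k) ℤ.* + 1 ≡ + k ℤ.* + n
    cross = trans (ℤₚ.*-identityʳ _) (trans (cong +_ (ℕₚ.*-comm n k)) (ℤₚ.pos-* k n))

  fromℕ-product-const : ∀ {A : Set} (f : A → ℕ) c (xs : List A) →
    All (λ x → fromℕ (f x) ≡ c) xs → fromℕ (product (map f xs)) ≡ c ^ℚ length xs
  fromℕ-product-const f c []       []           = refl
  fromℕ-product-const f c (x ∷ xs) (fx≡c ∷ eqs) =
    trans (fromℕ-* (f x) (product (map f xs))) (cong₂ _*_ fx≡c (fromℕ-product-const f c xs eqs))

  p-[q+r]≡p-q-r : ∀ p q r → p - (q + r) ≡ p - q - r
  p-[q+r]≡p-q-r p q r =
    trans (cong (λ x → p + x) (neg-distrib-+ q r)) (sym (+-assoc p (- q) (- r)))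

  fromℕ-regular-degree : ∀ {d n m r} .{{_ : NonZero n}} →
    d ℕ.+ (1 ℕ.+ 2 ℕ.* r) ≡ n ℕ.+ m → n ℕ.* r ≡ 2 ℕ.* m →
    fromℕ d ≡ fromℕ n + fromℕ m - fromℕ 1 - + (4 ℕ.* m) / n
  fromℕ-regular-degree {d} {n} {m} {r} degree-sum handshake = begin
    fromℕ d
      ≡⟨ fromℕ-cancelʳ d (1 ℕ.+ 2 ℕ.* r) degree-sum ⟩
    fromℕ (n ℕ.+ m) - fromℕ (1 ℕ.+ 2 ℕ.* r)
      ≡⟨ cong₂ _-_ (fromℕ-+ n m) (fromℕ-+ 1 (2 ℕ.* r)) ⟩
    fromℕ n + fromℕ m - (fromℕ 1 + fromℕ (2 ℕ.* r))
      ≡⟨ p-[q+r]≡p-q-r (fromℕ n + fromℕ m) (fromℕ 1) (fromℕ (2 ℕ.* r)) ⟩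
    fromℕ n + fromℕ m - fromℕ 1 - fromℕ (2 ℕ.* r)
      ≡⟨ cong (λ x → fromℕ n + fromℕ m - fromℕ 1 - x) (trans (cong (λ k → + k / n) 4m≡n*2r) (*-/-cancelˡ n (2 ℕ.* r))) ⟨
    fromℕ n + fromℕ m - fromℕ 1 - + (4 ℕ.* m) / n ∎
    where
    open ≡-Reasoning
    4m≡n*2r : 4 ℕ.* m ≡ n ℕ.* (2 ℕ.* r)
    4m≡n*2r = begin
      4 ℕ.* m            ≡⟨ ℕₚ.*-assoc 2 2 m ⟩
      2 ℕ.* (2 ℕ.* m)    ≡⟨ cong (2 ℕ.*_) handshake ⟨
      2 ℕ.* (n ℕ.* r)    ≡⟨ x∙yz≈y∙xz 2 n r ⟩
      n ℕ.* (2 ℕ.* r)    ∎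

open import Defs
open import Data.Nat using (ℕ; NonZero)
open import Data.Integer using (+_)
open import Data.Rational using (ℚ; _*_; _-_; _+_; _/_)
open import Relation.Binary.PropositionalEquality using (_≡_)

open Sums using (length-allFin)
open TransformationDegrees
open NatEmbedding
import Data.Nat
open import Data.Nat using () renaming (_+_ to _+ℕ_; _*_ to _*ℕ_)
open import Data.Nat.ListAction using (product)
open import Data.Rational.Properties using (*-comm)
open import Data.List using (map; allFin)
open import Data.List.Relation.Unary.All as All using ()
open import Data.Product using (_,_)
open import Data.Sum using (inj₁; inj₂)
open import Function using (_∘_)
open import Relation.Binary.PropositionalEquality
  using (trans; cong; cong₂; subst; module ≡-Reasoning)

corollary1 : (n : ℕ) → .{{_ : NonZero n}} → (G : SimpleGraph n) → Regular G →
    (+ NKtrans minus minus G) / 1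
      ≡ (((+ n) / 1 - (+ 2) / 1) ^ℚ numEdges G)
        * (((+ n) / 1 + (+ numEdges G) / 1 - (+ 1) / 1 - (+ (4 Data.Nat.* numEdges G)) / n) ^ℚ n)
corollary1 n@(Data.Nat.suc _) G (r , regular) = begin
  fromℕ (NKtrans minus minus G)       ≡⟨ cong fromℕ (NKtrans-split G minus minus) ⟩
  fromℕ (Πᵥ *ℕ Πₑ)                    ≡⟨ fromℕ-* Πᵥ Πₑ ⟩
  fromℕ Πᵥ * fromℕ Πₑ                 ≡⟨ cong₂ _*_ vertex-factor edge-factor ⟩
  vertexDegree ^ℚ n * edgeDegree ^ℚ m ≡⟨ *-comm (vertexDegree ^ℚ n) (edgeDegree ^ℚ m) ⟩
  edgeDegree ^ℚ m * vertexDegree ^ℚ n ∎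
  where
  open ≡-Reasoning
  tD = tDeg minus minus G
  m = numEdges G
  Πᵥ = product (map (tD ∘ inj₁) (allFin n))
  Πₑ = product (map (tD ∘ inj₂) (edges G))
  vertexDegree edgeDegree : ℚ
  vertexDegree = fromℕ n + fromℕ m - fromℕ 1 - (+ (4 *ℕ m)) / n
  edgeDegree = fromℕ n - fromℕ 2

  vertex : ∀ u → fromℕ (tD (inj₁ u)) ≡ vertexDegree
  vertex u = fromℕ-regular-degree (subst (λ d → tD (inj₁ u) +ℕ (1 +ℕ 2 *ℕ d) ≡ n +ℕ m) (regular u) (tDeg⁻⁻-inj₁ G u))
                                  (regular-handshake G regular)

  vertex-factor : fromℕ Πᵥ ≡ vertexDegree ^ℚ n
  vertex-factor = trans (fromℕ-product-const (tD ∘ inj₁) vertexDegree (allFin n) (All.universal vertex (allFin n)))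
                        (cong (vertexDegree ^ℚ_) (length-allFin n))

  edge-factor : fromℕ Πₑ ≡ edgeDegree ^ℚ m
  edge-factor = fromℕ-product-const (tD ∘ inj₂) edgeDegree (edges G) (All.map (fromℕ-cancelʳ _ 2) (tDeg⁻⁻-inj₂ G))
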